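{- For positive integers $m,n$, $\theta(K_{m,n}\times K_2)=\theta(K_{m,n})$.
   Context: The thickness $\theta(G)$ of a graph $G$ is the minimum number of planar subgraphs whose union is $G$. $K_{m,n}$ denotes the complete bipartite graph with parts of sizes $m$ and $n$. The Kronecker product $G\times H$ of graphs $G$ and $H$ has vertex set $V(G)\times V(H)$, with $(g,h)$ adjacent to $(g',h')$ if and only if $gg'\in E(G)$ and $hh'\in E(H)$. -}

module Defs where

open import Data.Nat using (ℕ; _≤_)
open import Data.Fin using (Fin)
open import Data.Integer as ℤ using (ℤ; _-_; _*_; _+_; 0ℤ)
open import Data.Product using (Σ; _×_; _,_)
open import Data.Sum using (_⊎_; inj₁; inj₂)
open import Data.Unit using (⊤)
open import Data.Empty using (⊥)
open import Relation.Nullary using (¬_)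
open import Relation.Binary.PropositionalEquality using (_≡_)

record Graph : Set₁ where
  field
    V    : Set
    Adj  : V → V → Set
    sym  : ∀ {u v} → Adj u v → Adj v u
    irr  : ∀ {u} → ¬ Adj u u
open Graph public

Point : Set
Point = ℤ × ℤ

-- twice the signed area of triangle p q r
orient : Point → Point → Point → ℤ
orient (px , py) (qx , qy) (rx , ry) =
  ((qx - px) * (ry - py)) - ((qy - py) * (rx - px))

OnSeg : Point → Point → Point → Set
OnSeg p@(px , py) q@(qx , qy) r@(rx , ry) =
  (orient p q r ≡ 0ℤ) ×
  (((px - rx) * (qx - rx)) + ((py - ry) * (qy - ry)) ℤ.≤ 0ℤ)

SegsMeet : Point → Point → Point → Point → Set
SegsMeet p q r s =
  ((orient p q r * orient p q s ℤ.< 0ℤ) × (orient r s p * orient r s q ℤ.< 0ℤ))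
  ⊎ OnSeg p q r ⊎ OnSeg p q s ⊎ OnSeg r s p ⊎ OnSeg r s q

-- Planarity: existence of a straight-line plane drawing with integer
-- coordinates (equivalent to planarity of finite graphs by Fáry's theorem
-- and scaling rational coordinates).

record StraightLineDrawing (V : Set) (E : V → V → Set) : Set where
  field
    pos       : V → Point
    injective : ∀ u v → pos u ≡ pos v → u ≡ v
    vertexOff : ∀ a b w → E a b → ¬ (w ≡ a) → ¬ (w ≡ b) →
                ¬ OnSeg (pos a) (pos b) (pos w)
    edgesOff  : ∀ a b c d → E a b → E c d →
                ¬ (a ≡ c) → ¬ (a ≡ d) → ¬ (b ≡ c) → ¬ (b ≡ d) →
                ¬ SegsMeet (pos a) (pos b) (pos c) (pos d)

Planar : (V : Set) → (V → V → Set) → Set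
Planar V E = StraightLineDrawing V E

-- G is the union of k planar subgraphs H₀,…,H_{k-1}
-- (each Hᵢ taken spanning, which is harmless: isolated vertices do not
-- affect planarity).
record PlanarDecomposition (G : Graph) (k : ℕ) : Set₁ where
  field
    H        : Fin k → V G → V G → Set
    Hsym     : ∀ i {u v} → H i u v → H i v u
    Hsub     : ∀ i {u v} → H i u v → Adj G u v
    Hcover   : ∀ {u v} → Adj G u v → Σ (Fin k) λ i → H i u v
    Hplanar  : ∀ i → Planar (V G) (H i)

IsThickness : Graph → ℕ → Set₁
IsThickness G t =
  PlanarDecomposition G t × (∀ k → PlanarDecomposition G k → t ≤ k)

BipAdj : (m n : ℕ) → (Fin m ⊎ Fin n) → (Fin m ⊎ Fin n) → Set
BipAdj m n (inj₁ _) (inj₂ _) = ⊤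
BipAdj m n (inj₂ _) (inj₁ _) = ⊤
BipAdj m n (inj₁ _) (inj₁ _) = ⊥
BipAdj m n (inj₂ _) (inj₂ _) = ⊥

K : ℕ → ℕ → Graph
K m n = record
  { V = Fin m ⊎ Fin n
  ; Adj = BipAdj m n
  ; sym = λ { {inj₁ _} {inj₂ _} _ → _ ; {inj₂ _} {inj₁ _} _ → _ }
  ; irr = λ { {inj₁ _} () ; {inj₂ _} () }
  }

Complete : ℕ → Graph
Complete n = record
  { V = Fin n
  ; Adj = λ u v → ¬ (u ≡ v)
  ; sym = λ p q → p (Relation.Binary.PropositionalEquality.sym q)
  ; irr = λ p → p Relation.Binary.PropositionalEquality.refl
  }

_⊗_ : Graph → Graph → Graph
G ⊗ H = record
  { V = V G × V H
  ; Adj = λ { (g , h) (g′ , h′) → Adj G g g′ × Adj H h h′ }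
  ; sym = λ { {_ , _} {_ , _} (p , q) → Graph.sym G p , Graph.sym H q }
  ; irr = λ { {_ , _} (p , _) → irr G p }
  }

-- Since K_{m,n} is bipartite, K_{m,n} × K₂ is two disjoint copies of K_{m,n}: the vertex (u, x)
-- lies in the first copy iff x is the colour of u. Each planar layer of a decomposition of K_{m,n}
-- therefore gives a planar layer of the product, drawing its two copies on either side of a
-- vertical line, which no edge can cross. Conversely K_{m,n} is the induced subgraph of the product
-- on the vertices (u, colour u), so decompositions of the product restrict to K_{m,n}.

module Submission where

open import Defs hiding (sym)
open import Data.Nat using (ℕ)
open import Data.Fin using (Fin; zero; suc; opposite)
open import Data.Product using (∃; _×_; _,_; proj₁; proj₂)
open import Data.Sum using (_⊎_; inj₁; inj₂)
open import Data.Sum.Relation.Binary.Pointwise using (Pointwise; inj₁; inj₂)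
open import Data.Empty using (⊥; ⊥-elim)
open import Function using (_∘_)
open import Function.Definitions using (Injective)
open import Relation.Nullary using (¬_)
open import Relation.Binary.PropositionalEquality

module IntegerSigns where

  open import Data.Integer
  open import Data.Integer.Properties

  pos*pos>0 : ∀ {i j} → 0ℤ < i → 0ℤ < j → 0ℤ < i * j
  pos*pos>0 {i} {j} 0<i 0<j = subst (_< i * j) (*-zeroʳ i) (*-monoˡ-<-pos i {{positive 0<i}} 0<j)

  neg*neg>0 : ∀ {i j} → i < 0ℤ → j < 0ℤ → 0ℤ < i * j
  neg*neg>0 {i} {j} i<0 j<0 = subst (_< i * j) (*-zeroʳ i) (*-monoˡ-<-neg i {{negative i<0}} j<0)

  neg*pos<0 : ∀ {i j} → i < 0ℤ → 0ℤ < j → i * j < 0ℤ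
  neg*pos<0 {i} {j} i<0 0<j = subst (i * j <_) (*-zeroʳ i) (*-monoˡ-<-neg i {{negative i<0}} 0<j)

  pos*nonPos≤0 : ∀ {i j} → 0ℤ < i → j ≤ 0ℤ → i * j ≤ 0ℤ
  pos*nonPos≤0 {i} {j} 0<i j≤0 =
    subst (i * j ≤_) (*-zeroʳ i) (*-monoˡ-≤-nonNeg i {{nonNegative (<⇒≤ 0<i)}} j≤0)

  neg*nonPos≥0 : ∀ {i j} → i < 0ℤ → j ≤ 0ℤ → 0ℤ ≤ i * j
  neg*nonPos≥0 {i} {j} i<0 j≤0 =
    subst (_≤ i * j) (*-zeroʳ i) (*-monoˡ-≤-nonPos i {{nonPositive (<⇒≤ i<0)}} j≤0)

  i*i≥0 : ∀ i → 0ℤ ≤ i * i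
  i*i≥0 +0       = ≤-refl
  i*i≥0 +[1+ _ ] = nonNegative⁻¹ _
  i*i≥0 -[1+ _ ] = nonNegative⁻¹ _

  i<j⇒i-j<0 : ∀ {i j} → i < j → i - j < 0ℤ
  i<j⇒i-j<0 {i} {j} i<j = subst (i - j <_) (+-inverseʳ j) (+-monoˡ-< (- j) i<j)

  i<j⇒0<j-i : ∀ {i j} → i < j → 0ℤ < j - i
  i<j⇒0<j-i {i} {j} i<j = subst (_< j - i) (+-inverseʳ i) (+-monoˡ-< (- i) i<j)

  data OppositeSigns (i j : ℤ) : Set where
    pos-neg : 0ℤ < i → j < 0ℤ → OppositeSigns i j
    neg-pos : i < 0ℤ → 0ℤ < j → OppositeSigns i j

  *-neg⇒oppositeSigns : ∀ i j → i * j < 0ℤ → OppositeSigns i j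
  *-neg⇒oppositeSigns i        +0       ij<0 = ⊥-elim (<-irrefl (*-zeroʳ i) ij<0)
  *-neg⇒oppositeSigns +0       _        ij<0 = ⊥-elim (<-irrefl refl ij<0)
  *-neg⇒oppositeSigns +[1+ _ ] -[1+ _ ] _    = pos-neg (positive⁻¹ _) (negative⁻¹ _)
  *-neg⇒oppositeSigns -[1+ _ ] +[1+ _ ] _    = neg-pos (negative⁻¹ _) (positive⁻¹ _)
  *-neg⇒oppositeSigns +[1+ _ ] +[1+ _ ] (+<+ ())
  *-neg⇒oppositeSigns -[1+ _ ] -[1+ _ ] (+<+ ())

module Segments where

  open import Data.Integer
  open import Data.Integer.Properties
  open import Data.Integer.Tactic.RingSolver using (solve-∀)
  open import Algebra.Properties.AbelianGroup +-0-abelianGroup using (∙-cancelʳ)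
  open IntegerSigns

  _+ᵖ_ : Point → Point → Point
  (px , py) +ᵖ (tx , ty) = px + tx , py + ty

  +ᵖ-cancelʳ : ∀ {p q} t → p +ᵖ t ≡ q +ᵖ t → p ≡ q
  +ᵖ-cancelʳ (tx , ty) eq =
    cong₂ _,_ (∙-cancelʳ tx _ _ (cong proj₁ eq)) (∙-cancelʳ ty _ _ (cong proj₂ eq))

  [i+k]-[j+k]≡i-j : ∀ i j k → (i + k) - (j + k) ≡ i - j
  [i+k]-[j+k]≡i-j = solve-∀

  orient-translate : ∀ p q r t → orient (p +ᵖ t) (q +ᵖ t) (r +ᵖ t) ≡ orient p q r
  orient-translate (px , py) (qx , qy) (rx , ry) (tx , ty) =
    cong₂ _-_ (cong₂ _*_ ([i+k]-[j+k]≡i-j qx px tx) ([i+k]-[j+k]≡i-j ry py ty))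
              (cong₂ _*_ ([i+k]-[j+k]≡i-j qy py ty) ([i+k]-[j+k]≡i-j rx px tx))

  OnSeg-translate : ∀ p q r t → OnSeg (p +ᵖ t) (q +ᵖ t) (r +ᵖ t) ≡ OnSeg p q r
  OnSeg-translate p@(px , py) q@(qx , qy) r@(rx , ry) t@(tx , ty) =
    cong₂ (λ o d → (o ≡ 0ℤ) × (d ≤ 0ℤ)) (orient-translate p q r t)
      (cong₂ _+_ (cong₂ _*_ ([i+k]-[j+k]≡i-j px rx tx) ([i+k]-[j+k]≡i-j qx rx tx))
                 (cong₂ _*_ ([i+k]-[j+k]≡i-j py ry ty) ([i+k]-[j+k]≡i-j qy ry ty)))

  SegsMeet-translate : ∀ p q r s t →
    SegsMeet (p +ᵖ t) (q +ᵖ t) (r +ᵖ t) (s +ᵖ t) ≡ SegsMeet p q r s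
  SegsMeet-translate p q r s t =
    cong₂ _⊎_
      (cong₂ _×_ (cong₂ (λ a b → a * b < 0ℤ) (orient-translate p q r t) (orient-translate p q s t))
                 (cong₂ (λ a b → a * b < 0ℤ) (orient-translate r s p t) (orient-translate r s q t)))
      (cong₂ _⊎_ (OnSeg-translate p q r t)
      (cong₂ _⊎_ (OnSeg-translate p q s t)
      (cong₂ _⊎_ (OnSeg-translate r s p t) (OnSeg-translate r s q t))))

  OnSeg⇒between : ∀ p q r → OnSeg p q r → (proj₁ p - proj₁ r) * (proj₁ q - proj₁ r) ≤ 0ℤ
  OnSeg⇒between (px , py) (qx , qy) (rx , ry) (collinear , inner≤0) = ≮⇒≥ λ 0<PQ →
    <⇒≱ (+-mono-<-≤ (pos*pos>0 0<PQ 0<PQ) (i*i≥0 (P * B)))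
        (subst (_≤ 0ℤ) sum-of-squares (pos*nonPos≤0 0<PQ inner≤0))
    where
    P = px - rx
    Q = qx - rx
    A = py - ry
    B = qy - ry

    orient-relative : ∀ px py qx qy rx ry →
      (qx - px) * (ry - py) - (qy - py) * (rx - px) ≡ (px - rx) * (qy - ry) - (qx - rx) * (py - ry)
    orient-relative = solve-∀

    PB≡QA : P * B ≡ Q * A
    PB≡QA = i-j≡0⇒i≡j _ _ (trans (sym (orient-relative px py qx qy rx ry)) collinear)

    expand : ∀ P Q A B → (P * Q) * (P * Q + A * B) ≡ (P * Q) * (P * Q) + (P * B) * (Q * A)
    expand = solve-∀

    sum-of-squares : (P * Q) * (P * Q + A * B) ≡ (P * Q) * (P * Q) + (P * B) * (P * B)
    sum-of-squares = begin
      (P * Q) * (P * Q + A * B)              ≡⟨ expand P Q A B ⟩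
      (P * Q) * (P * Q) + (P * B) * (Q * A)  ≡⟨ cong (λ z → (P * Q) * (P * Q) + (P * B) * z) PB≡QA ⟨
      (P * Q) * (P * Q) + (P * B) * (P * B)  ∎
      where open ≡-Reasoning

  OnSeg-left-right : ∀ p q r → proj₁ p ≤ 0ℤ → proj₁ q ≤ 0ℤ → 0ℤ < proj₁ r → ¬ OnSeg p q r
  OnSeg-left-right p q r p≤0 q≤0 0<r on =
    <⇒≱ (neg*neg>0 (i<j⇒i-j<0 (≤-<-trans p≤0 0<r)) (i<j⇒i-j<0 (≤-<-trans q≤0 0<r)))
        (OnSeg⇒between p q r on)

  OnSeg-right-left : ∀ p q r → 0ℤ < proj₁ p → 0ℤ < proj₁ q → proj₁ r ≤ 0ℤ → ¬ OnSeg p q r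
  OnSeg-right-left p q r 0<p 0<q r≤0 on =
    <⇒≱ (pos*pos>0 (i<j⇒0<j-i (≤-<-trans r≤0 0<p)) (i<j⇒0<j-i (≤-<-trans r≤0 0<q)))
        (OnSeg⇒between p q r on)

  orient-exchange : ∀ p q r s → orient r s q - orient r s p ≡ orient p q r - orient p q s
  orient-exchange (px , py) (qx , qy) (rx , ry) (sx , sy) = identity px py qx qy rx ry sx sy
    where
    identity : ∀ px py qx qy rx ry sx sy →
      ((sx - rx) * (qy - ry) - (sy - ry) * (qx - rx)) - ((sx - rx) * (py - ry) - (sy - ry) * (px - rx)) ≡
      ((qx - px) * (ry - py) - (qy - py) * (rx - px)) - ((qx - px) * (sy - py) - (qy - py) * (sx - px))
    identity = solve-∀

  orient-exchange-weighted : ∀ p q r s →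
    orient r s q * proj₁ p - orient r s p * proj₁ q ≡ orient p q r * proj₁ s - orient p q s * proj₁ r
  orient-exchange-weighted (px , py) (qx , qy) (rx , ry) (sx , sy) = identity px py qx qy rx ry sx sy
    where
    identity : ∀ px py qx qy rx ry sx sy →
      ((sx - rx) * (qy - ry) - (sy - ry) * (qx - rx)) * px - ((sx - rx) * (py - ry) - (sy - ry) * (px - rx)) * qx ≡
      ((qx - px) * (ry - py) - (qy - py) * (rx - px)) * sx - ((qx - px) * (sy - py) - (qy - py) * (sx - px)) * rx
    identity = solve-∀

  -- For a = orient p q r, b = orient p q s, c = orient r s p, d = orient r s q, the lines pq and rs
  -- meet at (a s − b r)/(a − b) on segment rs and at (d p − c q)/(d − c) on segment pq; the two
  -- identities equate these points' x-coordinates, one of which is positive and the other not.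
  intersection-sign-clash : ∀ {a b c d P Q R S} → OppositeSigns a b → OppositeSigns c d →
    d - c ≡ a - b → d * P - c * Q ≡ a * S - b * R →
    P ≤ 0ℤ → Q ≤ 0ℤ → 0ℤ < R → 0ℤ < S → ⊥
  intersection-sign-clash {a} {b} {c} {d} {P} {Q} {R} {S}
    (pos-neg 0<a b<0) (neg-pos c<0 0<d) _ weighted P≤0 Q≤0 0<R 0<S =
    <⇒≱ (i<j⇒0<j-i (<-trans (neg*pos<0 b<0 0<R) (pos*pos>0 0<a 0<S)))
        (subst (_≤ 0ℤ) weighted
          (i≤j⇒i-j≤0 (≤-trans (pos*nonPos≤0 0<d P≤0) (neg*nonPos≥0 c<0 Q≤0))))
  intersection-sign-clash {a} {b} {c} {d} {P} {Q} {R} {S}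
    (neg-pos a<0 0<b) (pos-neg 0<c d<0) _ weighted P≤0 Q≤0 0<R 0<S =
    <⇒≱ (i<j⇒i-j<0 (<-trans (neg*pos<0 a<0 0<S) (pos*pos>0 0<b 0<R)))
        (subst (0ℤ ≤_) weighted
          (i≤j⇒0≤j-i (≤-trans (pos*nonPos≤0 0<c Q≤0) (neg*nonPos≥0 d<0 P≤0))))
  intersection-sign-clash (pos-neg 0<a b<0) (pos-neg 0<c d<0) difference _ _ _ _ _ =
    <-asym (i<j⇒i-j<0 (<-trans d<0 0<c)) (subst (0ℤ <_) (sym difference) (i<j⇒0<j-i (<-trans b<0 0<a)))
  intersection-sign-clash (neg-pos a<0 0<b) (neg-pos c<0 0<d) difference _ _ _ _ _ =
    <-asym (i<j⇒0<j-i (<-trans c<0 0<d)) (subst (_< 0ℤ) (sym difference) (i<j⇒i-j<0 (<-trans a<0 0<b)))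

  SegsMeet-separated : ∀ p q r s → proj₁ p ≤ 0ℤ → proj₁ q ≤ 0ℤ → 0ℤ < proj₁ r → 0ℤ < proj₁ s →
    ¬ SegsMeet p q r s
  SegsMeet-separated p q r s p≤0 q≤0 0<r 0<s (inj₁ (pq-splits-rs , rs-splits-pq)) =
    intersection-sign-clash
      (*-neg⇒oppositeSigns (orient p q r) (orient p q s) pq-splits-rs)
      (*-neg⇒oppositeSigns (orient r s p) (orient r s q) rs-splits-pq)
      (orient-exchange p q r s) (orient-exchange-weighted p q r s) p≤0 q≤0 0<r 0<s
  SegsMeet-separated p q r s p≤0 q≤0 0<r 0<s (inj₂ (inj₁ r∈pq)) = OnSeg-left-right p q r p≤0 q≤0 0<r r∈pq
  SegsMeet-separated p q r s p≤0 q≤0 0<r 0<s (inj₂ (inj₂ (inj₁ s∈pq))) = OnSeg-left-right p q s p≤0 q≤0 0<s s∈pq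
  SegsMeet-separated p q r s p≤0 q≤0 0<r 0<s (inj₂ (inj₂ (inj₂ (inj₁ p∈rs)))) = OnSeg-right-left r s p 0<r 0<s p≤0 p∈rs
  SegsMeet-separated p q r s p≤0 q≤0 0<r 0<s (inj₂ (inj₂ (inj₂ (inj₂ q∈rs)))) = OnSeg-right-left r s q 0<r 0<s q≤0 q∈rs

  SegsMeet-sym : ∀ p q r s → SegsMeet p q r s → SegsMeet r s p q
  SegsMeet-sym _ _ _ _ (inj₁ (pq-splits-rs , rs-splits-pq))     = inj₁ (rs-splits-pq , pq-splits-rs)
  SegsMeet-sym _ _ _ _ (inj₂ (inj₁ r∈pq))                       = inj₂ (inj₂ (inj₂ (inj₁ r∈pq)))
  SegsMeet-sym _ _ _ _ (inj₂ (inj₂ (inj₁ s∈pq)))                = inj₂ (inj₂ (inj₂ (inj₂ s∈pq)))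
  SegsMeet-sym _ _ _ _ (inj₂ (inj₂ (inj₂ (inj₁ p∈rs))))         = inj₂ (inj₁ p∈rs)
  SegsMeet-sym _ _ _ _ (inj₂ (inj₂ (inj₂ (inj₂ q∈rs))))         = inj₂ (inj₂ (inj₁ q∈rs))

module Drawings where

  open import Data.Integer using (ℤ; 0ℤ; _≤_; _<_; -_; _-_; _⊔_; pred)
  open import Data.Integer.Properties
  open IntegerSigns using (i<j⇒0<j-i)
  open Segments
  open StraightLineDrawing

  private
    variable
      A B : Set
      E : A → A → Set
      F : B → B → Set

  translate : Point → StraightLineDrawing A E → StraightLineDrawing A E
  translate t d = record
    { pos       = λ v → pos d v +ᵖ t
    ; injective = λ u v eq → injective d u v (+ᵖ-cancelʳ t eq)
    ; vertexOff = λ a b w e w≢a w≢b →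
        subst ¬_ (sym (OnSeg-translate (pos d a) (pos d b) (pos d w) t)) (vertexOff d a b w e w≢a w≢b)
    ; edgesOff  = λ a b c d′ e₁ e₂ a≢c a≢d b≢c b≢d →
        subst ¬_ (sym (SegsMeet-translate (pos d a) (pos d b) (pos d c) (pos d d′) t))
          (edgesOff d a b c d′ e₁ e₂ a≢c a≢d b≢c b≢d)
    }

  pullback : (φ : B → A) → Injective _≡_ _≡_ φ → (∀ {u v} → F u v → E (φ u) (φ v)) →
    StraightLineDrawing A E → StraightLineDrawing B F
  pullback φ φ-injective φ-edge d = record
    { pos       = pos d ∘ φ
    ; injective = λ u v eq → φ-injective (injective d (φ u) (φ v) eq)
    ; vertexOff = λ a b w e w≢a w≢b →
        vertexOff d (φ a) (φ b) (φ w) (φ-edge e) (w≢a ∘ φ-injective) (w≢b ∘ φ-injective)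
    ; edgesOff  = λ a b c d′ e₁ e₂ a≢c a≢d b≢c b≢d →
        edgesOff d (φ a) (φ b) (φ c) (φ d′) (φ-edge e₁) (φ-edge e₂)
          (a≢c ∘ φ-injective) (a≢d ∘ φ-injective) (b≢c ∘ φ-injective) (b≢d ∘ φ-injective)
    }

  sideBySide : (d₁ : StraightLineDrawing A E) (d₂ : StraightLineDrawing B F) →
    (∀ v → proj₁ (pos d₁ v) ≤ 0ℤ) → (∀ w → 0ℤ < proj₁ (pos d₂ w)) →
    StraightLineDrawing (A ⊎ B) (Pointwise E F)
  sideBySide {A = A} {E = E} {B = B} {F = F} d₁ d₂ left right = record
    { pos       = pos′
    ; injective = injective′
    ; vertexOff = vertexOff′
    ; edgesOff  = edgesOff′
    }
    where
    pos′ : A ⊎ B → Point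
    pos′ (inj₁ v) = pos d₁ v
    pos′ (inj₂ w) = pos d₂ w

    injective′ : ∀ u v → pos′ u ≡ pos′ v → u ≡ v
    injective′ (inj₁ u) (inj₁ v) eq = cong inj₁ (injective d₁ u v eq)
    injective′ (inj₂ u) (inj₂ v) eq = cong inj₂ (injective d₂ u v eq)
    injective′ (inj₁ u) (inj₂ v) eq = ⊥-elim (<⇒≱ (right v) (subst (_≤ 0ℤ) (cong proj₁ eq) (left u)))
    injective′ (inj₂ u) (inj₁ v) eq = ⊥-elim (<⇒≱ (right u) (subst (_≤ 0ℤ) (cong proj₁ (sym eq)) (left v)))

    vertexOff′ : ∀ a b w → Pointwise E F a b → ¬ w ≡ a → ¬ w ≡ b → ¬ OnSeg (pos′ a) (pos′ b) (pos′ w)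
    vertexOff′ (inj₁ a) (inj₁ b) (inj₁ w) (inj₁ e) w≢a w≢b =
      vertexOff d₁ a b w e (w≢a ∘ cong inj₁) (w≢b ∘ cong inj₁)
    vertexOff′ (inj₂ a) (inj₂ b) (inj₂ w) (inj₂ e) w≢a w≢b =
      vertexOff d₂ a b w e (w≢a ∘ cong inj₂) (w≢b ∘ cong inj₂)
    vertexOff′ (inj₁ a) (inj₁ b) (inj₂ w) (inj₁ e) _ _ =
      OnSeg-left-right (pos d₁ a) (pos d₁ b) (pos d₂ w) (left a) (left b) (right w)
    vertexOff′ (inj₂ a) (inj₂ b) (inj₁ w) (inj₂ e) _ _ =
      OnSeg-right-left (pos d₂ a) (pos d₂ b) (pos d₁ w) (right a) (right b) (left w)

    edgesOff′ : ∀ a b c d → Pointwise E F a b → Pointwise E F c d →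
      ¬ a ≡ c → ¬ a ≡ d → ¬ b ≡ c → ¬ b ≡ d → ¬ SegsMeet (pos′ a) (pos′ b) (pos′ c) (pos′ d)
    edgesOff′ (inj₁ a) (inj₁ b) (inj₁ c) (inj₁ d) (inj₁ e₁) (inj₁ e₂) a≢c a≢d b≢c b≢d =
      edgesOff d₁ a b c d e₁ e₂ (a≢c ∘ cong inj₁) (a≢d ∘ cong inj₁) (b≢c ∘ cong inj₁) (b≢d ∘ cong inj₁)
    edgesOff′ (inj₂ a) (inj₂ b) (inj₂ c) (inj₂ d) (inj₂ e₁) (inj₂ e₂) a≢c a≢d b≢c b≢d =
      edgesOff d₂ a b c d e₁ e₂ (a≢c ∘ cong inj₂) (a≢d ∘ cong inj₂) (b≢c ∘ cong inj₂) (b≢d ∘ cong inj₂)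
    edgesOff′ (inj₁ a) (inj₁ b) (inj₂ c) (inj₂ d) (inj₁ _) (inj₂ _) _ _ _ _ =
      SegsMeet-separated (pos d₁ a) (pos d₁ b) (pos d₂ c) (pos d₂ d) (left a) (left b) (right c) (right d)
    edgesOff′ (inj₂ a) (inj₂ b) (inj₁ c) (inj₁ d) (inj₂ _) (inj₁ _) _ _ _ _ =
      SegsMeet-separated (pos d₁ c) (pos d₁ d) (pos d₂ a) (pos d₂ b) (left c) (left d) (right a) (right b)
      ∘ SegsMeet-sym (pos d₂ a) (pos d₂ b) (pos d₁ c) (pos d₁ d)

  BoundedAbove : (A → ℤ) → Set
  BoundedAbove {A = A} f = ∃ λ U → ∀ (a : A) → f a ≤ U

  BoundedBelow : (A → ℤ) → Set
  BoundedBelow {A = A} f = ∃ λ L → ∀ (a : A) → L ≤ f a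

  Fin-boundedAbove : ∀ {k} (f : Fin k → ℤ) → BoundedAbove f
  Fin-boundedAbove {ℕ.zero}  f = 0ℤ , λ ()
  Fin-boundedAbove {ℕ.suc k} f with Fin-boundedAbove (f ∘ suc)
  ... | U , f∘suc≤U = f zero ⊔ U , λ where
    zero    → i≤i⊔j (f zero) U
    (suc i) → i≤j⇒i≤k⊔j (f zero) (f∘suc≤U i)

  ⊎-boundedAbove : (f : A ⊎ B → ℤ) → BoundedAbove (f ∘ inj₁) → BoundedAbove (f ∘ inj₂) → BoundedAbove f
  ⊎-boundedAbove f (U₁ , ≤U₁) (U₂ , ≤U₂) = U₁ ⊔ U₂ , λ where
    (inj₁ a) → i≤j⇒i≤j⊔k U₂ (≤U₁ a)
    (inj₂ b) → i≤j⇒i≤k⊔j U₁ (≤U₂ b)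

  neg-boundedAbove⇒boundedBelow : (f : A → ℤ) → BoundedAbove (-_ ∘ f) → BoundedBelow f
  neg-boundedAbove⇒boundedBelow f (U , -f≤U) =
    - U , λ a → subst (- U ≤_) (neg-involutive (f a)) (neg-mono-≤ (-f≤U a))

  Fin⊎Fin-boundedAbove : ∀ {k l} (f : Fin k ⊎ Fin l → ℤ) → BoundedAbove f
  Fin⊎Fin-boundedAbove f = ⊎-boundedAbove f (Fin-boundedAbove (f ∘ inj₁)) (Fin-boundedAbove (f ∘ inj₂))

  Fin⊎Fin-boundedBelow : ∀ {k l} (f : Fin k ⊎ Fin l → ℤ) → BoundedBelow f
  Fin⊎Fin-boundedBelow f = neg-boundedAbove⇒boundedBelow f (Fin⊎Fin-boundedAbove (-_ ∘ f))

  disjointUnion : (d₁ : StraightLineDrawing A E) (d₂ : StraightLineDrawing B F) →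
    BoundedAbove (proj₁ ∘ pos d₁) → BoundedBelow (proj₁ ∘ pos d₂) →
    StraightLineDrawing (A ⊎ B) (Pointwise E F)
  disjointUnion d₁ d₂ (U , ≤U) (L , L≤) =
    sideBySide (translate (- U , 0ℤ) d₁) (translate (- pred L , 0ℤ) d₂)
      (λ v → i≤j⇒i-j≤0 (≤U v))
      (λ w → i<j⇒0<j-i (i≤pred[j]⇒i<j {j = proj₁ (pos d₂ w)} (pred-mono (L≤ w))))

PlanarDecomposition-pullback : ∀ {G H k} (φ : V H → V G) → Injective _≡_ _≡_ φ →
  (∀ {u v} → Adj H u v → Adj G (φ u) (φ v)) → (∀ {u v} → Adj G (φ u) (φ v) → Adj H u v) →
  PlanarDecomposition G k → PlanarDecomposition H k
PlanarDecomposition-pullback φ φ-injective φ-preserves φ-reflects P = record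
  { H       = λ i u v → H i (φ u) (φ v)
  ; Hsym    = λ i → Hsym i
  ; Hsub    = λ i → φ-reflects ∘ Hsub i
  ; Hcover  = Hcover ∘ φ-preserves
  ; Hplanar = λ i → Drawings.pullback φ φ-injective (λ h → h) (Hplanar i)
  }
  where open PlanarDecomposition P

IsThickness-transfer : ∀ {G H} → (∀ k → PlanarDecomposition G k → PlanarDecomposition H k) →
  (∀ k → PlanarDecomposition H k → PlanarDecomposition G k) →
  ∀ {t} → IsThickness G t → IsThickness H t
IsThickness-transfer G→H H→G {t} (P , minimal) = G→H t P , λ k Q → minimal k (H→G k Q)

DoubleCover : {A : Set} → (A → A → Set) → A × Fin 2 → A × Fin 2 → Set
DoubleCover E (u , x) (v , y) = E u v × ¬ x ≡ y

module CompleteBipartiteDoubleCover (m n : ℕ) where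

  colour : Fin m ⊎ Fin n → Fin 2
  colour (inj₁ _) = zero
  colour (inj₂ _) = suc zero

  colour-proper : ∀ {u v} → BipAdj m n u v → ¬ colour u ≡ colour v
  colour-proper {inj₁ _} {inj₂ _} _ ()
  colour-proper {inj₂ _} {inj₁ _} _ ()

  toTwoCopies : (Fin m ⊎ Fin n) × Fin 2 → (Fin m ⊎ Fin n) ⊎ (Fin m ⊎ Fin n)
  toTwoCopies (inj₁ a , zero)     = inj₁ (inj₁ a)
  toTwoCopies (inj₂ b , suc zero) = inj₁ (inj₂ b)
  toTwoCopies (inj₁ a , suc zero) = inj₂ (inj₁ a)
  toTwoCopies (inj₂ b , zero)     = inj₂ (inj₂ b)

  fromTwoCopies : (Fin m ⊎ Fin n) ⊎ (Fin m ⊎ Fin n) → (Fin m ⊎ Fin n) × Fin 2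
  fromTwoCopies (inj₁ u) = u , colour u
  fromTwoCopies (inj₂ u) = u , opposite (colour u)

  fromTwoCopies∘toTwoCopies : ∀ v → fromTwoCopies (toTwoCopies v) ≡ v
  fromTwoCopies∘toTwoCopies (inj₁ a , zero)     = refl
  fromTwoCopies∘toTwoCopies (inj₂ b , suc zero) = refl
  fromTwoCopies∘toTwoCopies (inj₁ a , suc zero) = refl
  fromTwoCopies∘toTwoCopies (inj₂ b , zero)     = refl

  toTwoCopies-injective : Injective _≡_ _≡_ toTwoCopies
  toTwoCopies-injective {v} {w} eq = begin
    v                               ≡⟨ fromTwoCopies∘toTwoCopies v ⟨
    fromTwoCopies (toTwoCopies v)   ≡⟨ cong fromTwoCopies eq ⟩
    fromTwoCopies (toTwoCopies w)   ≡⟨ fromTwoCopies∘toTwoCopies w ⟩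
    w                               ∎
    where open ≡-Reasoning

  toTwoCopies-edge : ∀ {E : Fin m ⊎ Fin n → Fin m ⊎ Fin n → Set} →
    (∀ {u v} → E u v → BipAdj m n u v) → ∀ {a b} → DoubleCover E a b → Pointwise E E (toTwoCopies a) (toTwoCopies b)
  toTwoCopies-edge E⊆K {inj₁ _ , zero}     {inj₂ _ , suc zero} (e , _) = inj₁ e
  toTwoCopies-edge E⊆K {inj₂ _ , suc zero} {inj₁ _ , zero}     (e , _) = inj₁ e
  toTwoCopies-edge E⊆K {inj₁ _ , suc zero} {inj₂ _ , zero}     (e , _) = inj₂ e
  toTwoCopies-edge E⊆K {inj₂ _ , zero}     {inj₁ _ , suc zero} (e , _) = inj₂ e
  toTwoCopies-edge E⊆K {inj₁ _ , zero}     {inj₂ _ , zero}     (_ , x≢y) = ⊥-elim (x≢y refl)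
  toTwoCopies-edge E⊆K {inj₁ _ , suc zero} {inj₂ _ , suc zero} (_ , x≢y) = ⊥-elim (x≢y refl)
  toTwoCopies-edge E⊆K {inj₂ _ , zero}     {inj₁ _ , zero}     (_ , x≢y) = ⊥-elim (x≢y refl)
  toTwoCopies-edge E⊆K {inj₂ _ , suc zero} {inj₁ _ , suc zero} (_ , x≢y) = ⊥-elim (x≢y refl)
  toTwoCopies-edge E⊆K {inj₁ _ , _}        {inj₁ _ , _}        (e , _) = ⊥-elim (E⊆K e)
  toTwoCopies-edge E⊆K {inj₂ _ , _}        {inj₂ _ , _}        (e , _) = ⊥-elim (E⊆K e)

  DoubleCover-planar : ∀ {E} → (∀ {u v} → E u v → BipAdj m n u v) →
    Planar (Fin m ⊎ Fin n) E → Planar ((Fin m ⊎ Fin n) × Fin 2) (DoubleCover E)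
  DoubleCover-planar E⊆K d =
    pullback toTwoCopies toTwoCopies-injective (toTwoCopies-edge E⊆K)
      (disjointUnion d d (Fin⊎Fin-boundedAbove _) (Fin⊎Fin-boundedBelow _))
    where open Drawings

  DoubleCover-decomposition : ∀ {k} →
    PlanarDecomposition (K m n) k → PlanarDecomposition (K m n ⊗ Complete 2) k
  DoubleCover-decomposition P = record
    { H       = λ i → DoubleCover (H i)
    ; Hsym    = λ i (h , x≢y) → Hsym i h , x≢y ∘ sym
    ; Hsub    = λ i (h , x≢y) → Hsub i h , x≢y
    ; Hcover  = λ (uv , x≢y) → proj₁ (Hcover uv) , proj₂ (Hcover uv) , x≢y
    ; Hplanar = λ i → DoubleCover-planar (Hsub i) (Hplanar i)
    }
    where open PlanarDecomposition P

  embed : Fin m ⊎ Fin n → (Fin m ⊎ Fin n) × Fin 2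
  embed u = u , colour u

  restriction-decomposition : ∀ {k} →
    PlanarDecomposition (K m n ⊗ Complete 2) k → PlanarDecomposition (K m n) k
  restriction-decomposition =
    PlanarDecomposition-pullback embed (cong proj₁) (λ uv → uv , colour-proper uv) proj₁

open import Data.Nat using (_≤_)

corollary3p7 : (m n : ℕ) → 1 ≤ m → 1 ≤ n → (t : ℕ) →
    (IsThickness (K m n ⊗ Complete 2) t → IsThickness (K m n) t) ×
    (IsThickness (K m n) t → IsThickness (K m n ⊗ Complete 2) t)
corollary3p7 m n _ _ t =
  IsThickness-transfer (λ _ → restriction-decomposition) (λ _ → DoubleCover-decomposition) ,
  IsThickness-transfer (λ _ → DoubleCover-decomposition) (λ _ → restriction-decomposition)
  where open CompleteBipartiteDoubleCover m n
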